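{- A connected vertex domination-critical graph $G$ is a hypo-efficient domination graph if and only if $G-v$ has an efficient dominating set for every $v\in V(G)$.
   Context: All graphs are finite, simple and undirected. A dominating set of $G$ is a set $D\subseteq V(G)$ such that every vertex not in $D$ has a neighbor in $D$; $\gamma(G)$ is the minimum size of a dominating set. $G$ is a vertex domination-critical graph if $\gamma(G-v)<\gamma(G)$ for every $v\in V(G)$. An efficient dominating set (EDS) of $G$ is a set $D\subseteq V(G)$ with $|N[v]\cap D|=1$ for every $v\in V(G)$, where $N[v]$ is the closed neighborhood of $v$. A graph $G$ is a hypo-efficient domination graph if $G$ has no EDS but $G-v$ has at least one EDS for every $v\in V(G)$. -}

module Defs where

open import Data.Nat using (ℕ; suc; _<_; _≤_)
open import Data.Fin using (Fin; punchIn)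
open import Data.Fin.Subset using (Subset; _∈_; _∉_; ∣_∣)
open import Data.Product using (Σ; ∃; ∃-syntax; _×_)
open import Data.Empty using (⊥)
open import Data.Sum using (_⊎_)
open import Relation.Nullary using (¬_)
open import Relation.Binary.PropositionalEquality using (_≡_)
open import Relation.Binary.Construct.Closure.ReflexiveTransitive using (Star)

record Graph (n : ℕ) : Set₁ where
  field
    Adj   : Fin n → Fin n → Set
    sym   : ∀ {u v} → Adj u v → Adj v u
    irrefl : ∀ {v} → ¬ Adj v v
open Graph public

-- G - v : delete vertex v; vertices of G - v are relabelled via punchIn v.
_─_ : ∀ {m} → Graph (suc m) → Fin (suc m) → Graph m
G ─ v = record
  { Adj = λ i j → Adj G (punchIn v i) (punchIn v j)
  ; sym = sym G
  ; irrefl = irrefl G }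

-- closed neighbourhood membership: u ∈ N[v]
InN[_] : ∀ {n} (G : Graph n) → Fin n → Fin n → Set
InN[ G ] v u = (u ≡ v) ⊎ Adj G v u

IsDominating : ∀ {n} → Graph n → Subset n → Set
IsDominating G D = ∀ v → v ∉ D → ∃[ u ] (u ∈ D × Adj G v u)

IsDomNumber : ∀ {n} → Graph n → ℕ → Set
IsDomNumber G k =
  (∃[ D ] (IsDominating G D × ∣ D ∣ ≡ k)) ×
  (∀ D → IsDominating G D → k ≤ ∣ D ∣)

IsVertexDomCritical : ∀ {m} → Graph (suc m) → Set
IsVertexDomCritical G =
  ∀ v k k' → IsDomNumber G k → IsDomNumber (G ─ v) k' → k' < k

IsEDS : ∀ {n} → Graph n → Subset n → Set
IsEDS G D = ∀ v → ∃[ u ] ((u ∈ D × InN[ G ] v u) ×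
                          (∀ w → w ∈ D → InN[ G ] v w → w ≡ u))

HasEDS : ∀ {n} → Graph n → Set
HasEDS G = ∃[ D ] IsEDS G D

IsHypoEfficient : ∀ {m} → Graph (suc m) → Set
IsHypoEfficient G = ¬ HasEDS G × (∀ v → HasEDS (G ─ v))

Connected : ∀ {n} → Graph n → Set
Connected G = ∀ u v → Star (Adj G) u v

-- If D is an efficient dominating set of G, the closed neighbourhoods of the
-- vertices of D partition V(G), so every dominating set meets each of them and
-- γ(G) = |D|.  When G has an edge, D misses some vertex w, and D is still an
-- efficient dominating set of G - w; hence γ(G - w) = |D| = γ(G), which a
-- vertex domination-critical graph forbids.  So such a G never has an EDS, and
-- being hypo-efficient reduces to every G - v having one.
module Submission where

open import Defs
open import Data.Nat using (ℕ; suc; zero; _≤_; z≤n; s≤s)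
open import Data.Nat.Properties using (<-irrefl; ≤-trans; ≤-reflexive; suc-injective)
open import Data.Product using (_×_; _,_; proj₁; proj₂; ∃-syntax)
open import Data.Sum using (inj₁; inj₂)
open import Data.Empty using (⊥-elim)
open import Data.Vec using (_∷_; here; there; removeAt)
open import Data.Fin using (Fin; zero; suc; punchIn; punchOut)
open import Data.Fin.Properties using (punchIn-injective; punchIn-punchOut)
open import Data.Fin.Subset using (Subset; _∈_; _∉_; ∣_∣; inside; outside; _-_) renaming (_─_ to _∖_)
open import Data.Fin.Subset.Properties
  using (_∈?_; nonempty?; Empty-unique; ∣⊥∣≡0; p─⊥≡p; x∉⁅y⁆⇒x≢y; p─q⊆p; x∈p∧x≢y⇒x∈p-y; x∈p⇒∣p-x∣<∣p∣)
open import Relation.Nullary using (¬_; yes; no)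
open import Relation.Binary.PropositionalEquality
  using (_≡_; _≢_; refl; trans; cong; subst) renaming (sym to ≡-sym)
open import Relation.Binary.Construct.Closure.ReflexiveTransitive using (_◅_)
open import Function using (_∘_)
open import Function.Bundles using (_⇔_; mk⇔)

private
  variable
    n : ℕ

punchIn-surjective : ∀ (i : Fin (suc n)) {j} → i ≢ j → ∃[ k ] punchIn i k ≡ j
punchIn-surjective i i≢j = punchOut i≢j , punchIn-punchOut i≢j

∣p∣≡1+∣p-x∣ : ∀ {x : Fin n} {p} → x ∈ p → ∣ p ∣ ≡ suc ∣ p - x ∣
∣p∣≡1+∣p-x∣ {p = _ ∷ p}       here      = cong (suc ∘ ∣_∣) (≡-sym (p─⊥≡p p))
∣p∣≡1+∣p-x∣ {p = outside ∷ p} (there x∈p) = ∣p∣≡1+∣p-x∣ x∈p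
∣p∣≡1+∣p-x∣ {p = inside ∷ p}  (there x∈p) = cong suc (∣p∣≡1+∣p-x∣ x∈p)

x∈p∖q⇒x∉q : ∀ {x : Fin n} {p q} → x ∈ p ∖ q → x ∉ q
x∈p∖q⇒x∉q {p = _ ∷ p} {outside ∷ q} here        ()
x∈p∖q⇒x∉q {p = _ ∷ p} {_ ∷ q}       (there x∈) (there x∈q) = x∈p∖q⇒x∉q x∈ x∈q

x∈p-y⇒x≢y : ∀ {x y : Fin n} {p} → x ∈ p - y → x ≢ y
x∈p-y⇒x≢y x∈ = x∉⁅y⁆⇒x≢y (x∈p∖q⇒x∉q x∈)

injectiveOn⇒∣p∣≤∣q∣ : ∀ {m} {p : Subset n} {q : Subset m} (f : Fin n → Fin m) →
  (∀ {x} → x ∈ p → f x ∈ q) →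
  (∀ {x y} → x ∈ p → y ∈ p → f x ≡ f y → x ≡ y) →
  ∣ p ∣ ≤ ∣ q ∣
injectiveOn⇒∣p∣≤∣q∣ {n} {p = p} f maps inj = go _ p refl maps inj
  where
  go : ∀ k p {q} → ∣ p ∣ ≡ k → (∀ {x} → x ∈ p → f x ∈ q) →
       (∀ {x y} → x ∈ p → y ∈ p → f x ≡ f y → x ≡ y) → ∣ p ∣ ≤ ∣ q ∣
  go k p _ _ _ with nonempty? p
  go k p {q} _ _ _ | no p-empty =
    ≤-trans (≤-reflexive (trans (cong ∣_∣ (Empty-unique p-empty)) (∣⊥∣≡0 n))) z≤n
  go zero p ∣p∣≡0 _ _ | yes (x , x∈p) with () ← trans (≡-sym (∣p∣≡1+∣p-x∣ x∈p)) ∣p∣≡0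
  go (suc k) p {q} ∣p∣≡1+k maps inj | yes (x , x∈p) =
    subst (_≤ ∣ q ∣) (≡-sym (∣p∣≡1+∣p-x∣ x∈p))
      (≤-trans (s≤s (go k (p - x) ∣p-x∣≡k maps′ inj′)) (x∈p⇒∣p-x∣<∣p∣ (maps x∈p)))
    where
    ∣p-x∣≡k : ∣ p - x ∣ ≡ k
    ∣p-x∣≡k = suc-injective (trans (≡-sym (∣p∣≡1+∣p-x∣ x∈p)) ∣p∣≡1+k)
    inj′ : ∀ {y z} → y ∈ p - x → z ∈ p - x → f y ≡ f z → y ≡ z
    inj′ y∈ z∈ = inj (p─q⊆p _ _ y∈) (p─q⊆p _ _ z∈)
    maps′ : ∀ {y} → y ∈ p - x → f y ∈ q - f x
    maps′ y∈ = x∈p∧x≢y⇒x∈p-y (maps (p─q⊆p _ _ y∈))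
                 (x∈p-y⇒x≢y y∈ ∘ inj (p─q⊆p _ _ y∈) x∈p)

punchIn∈p⇒∈removeAt : ∀ (w : Fin (suc n)) {p y} → punchIn w y ∈ p → y ∈ removeAt p w
punchIn∈p⇒∈removeAt zero                   (there y∈p) = y∈p
punchIn∈p⇒∈removeAt {suc n} (suc w) {_ ∷ _ ∷ _} {zero}  here        = here
punchIn∈p⇒∈removeAt {suc n} (suc w) {_ ∷ _ ∷ _} {suc y} (there y∈p) = there (punchIn∈p⇒∈removeAt w y∈p)

∈removeAt⇒punchIn∈p : ∀ (w : Fin (suc n)) {p y} → y ∈ removeAt p w → punchIn w y ∈ p
∈removeAt⇒punchIn∈p zero {_ ∷ p} y∈ = there y∈
∈removeAt⇒punchIn∈p {suc n} (suc w) {_ ∷ _ ∷ _} {zero}  here       = here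
∈removeAt⇒punchIn∈p {suc n} (suc w) {_ ∷ _ ∷ _} {suc y} (there y∈) = there (∈removeAt⇒punchIn∈p w y∈)

∣removeAt∣≡∣p∣ : ∀ (w : Fin (suc n)) {p} → w ∉ p → ∣ removeAt p w ∣ ≡ ∣ p ∣
∣removeAt∣≡∣p∣ zero {outside ∷ p} _ = refl
∣removeAt∣≡∣p∣ zero {inside ∷ p}  w∉p = ⊥-elim (w∉p here)
∣removeAt∣≡∣p∣ {suc n} (suc w) {outside ∷ _ ∷ _} w∉p = ∣removeAt∣≡∣p∣ w (w∉p ∘ there)
∣removeAt∣≡∣p∣ {suc n} (suc w) {inside ∷ _ ∷ _}  w∉p = cong suc (∣removeAt∣≡∣p∣ w (w∉p ∘ there))

module _ (G : Graph n) where

  IsDominating⇒∈N[] : ∀ {S} → IsDominating G S → ∀ v → ∃[ u ] (u ∈ S × InN[ G ] u v)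
  IsDominating⇒∈N[] {S} dom v with v ∈? S
  ... | yes v∈S = v , v∈S , inj₁ refl
  ... | no  v∉S with u , u∈S , v~u ← dom v v∉S = u , u∈S , inj₂ (Graph.sym G v~u)

  IsEDS⇒IsDominating : ∀ {D} → IsEDS G D → IsDominating G D
  IsEDS⇒IsDominating eds v v∉D with eds v
  ... | _ , (u∈D , inj₁ refl) , _ = ⊥-elim (v∉D u∈D)
  ... | u , (u∈D , inj₂ v~u)  , _ = u , u∈D , v~u

  IsEDS-unique : ∀ {D v x y} → IsEDS G D → x ∈ D → y ∈ D →
                 InN[ G ] v x → InN[ G ] v y → x ≡ y
  IsEDS-unique {v = v} eds x∈D y∈D x∈N y∈N with _ , _ , unique ← eds v =
    trans (unique _ x∈D x∈N) (≡-sym (unique _ y∈D y∈N))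

  -- The closed neighbourhoods of the vertices of an EDS are pairwise disjoint,
  -- so sending each vertex to a dominator in S is injective on the EDS.
  IsEDS⇒∣D∣≤∣S∣ : ∀ {D S} → IsEDS G D → IsDominating G S → ∣ D ∣ ≤ ∣ S ∣
  IsEDS⇒∣D∣≤∣S∣ {D} {S} eds dom =
    injectiveOn⇒∣p∣≤∣q∣ dominator (λ {v} _ → dominator∈S v) injective
    where
    dominator : Fin n → Fin n
    dominator v = proj₁ (IsDominating⇒∈N[] dom v)
    dominator∈S : ∀ v → dominator v ∈ S
    dominator∈S v = proj₁ (proj₂ (IsDominating⇒∈N[] dom v))
    ∈N[dominator] : ∀ v → InN[ G ] (dominator v) v
    ∈N[dominator] v = proj₂ (proj₂ (IsDominating⇒∈N[] dom v))
    injective : ∀ {x y} → x ∈ D → y ∈ D → dominator x ≡ dominator y → x ≡ y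
    injective {x} {y} x∈D y∈D eq =
      IsEDS-unique eds x∈D y∈D (∈N[dominator] x)
        (subst (λ u → InN[ G ] u y) (≡-sym eq) (∈N[dominator] y))

  IsEDS⇒IsDomNumber : ∀ {D} → IsEDS G D → IsDomNumber G ∣ D ∣
  IsEDS⇒IsDomNumber eds = (_ , IsEDS⇒IsDominating eds , refl) , λ S → IsEDS⇒∣D∣≤∣S∣ eds

  IsEDS⇒¬Adj : ∀ {D u v} → IsEDS G D → u ∈ D → v ∈ D → ¬ Adj G u v
  IsEDS⇒¬Adj eds u∈D v∈D u~v with refl ← IsEDS-unique eds u∈D v∈D (inj₁ refl) (inj₂ u~v) =
    Graph.irrefl G u~v

  IsEDS⇒∃∉ : ∀ {D u v} → IsEDS G D → Adj G u v → ∃[ w ] w ∉ D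
  IsEDS⇒∃∉ {D} {u} {v} eds u~v with u ∈? D | v ∈? D
  ... | no u∉D | _       = u , u∉D
  ... | yes _  | no v∉D  = v , v∉D
  ... | yes u∈D | yes v∈D = ⊥-elim (IsEDS⇒¬Adj eds u∈D v∈D u~v)

module _ {m} (G : Graph (suc m)) (w : Fin (suc m)) where

  InN[─]⇒InN[] : ∀ {v y} → InN[ G ─ w ] v y → InN[ G ] (punchIn w v) (punchIn w y)
  InN[─]⇒InN[] (inj₁ refl) = inj₁ refl
  InN[─]⇒InN[] (inj₂ v~y)  = inj₂ v~y

  InN[]⇒InN[─] : ∀ {v y} → InN[ G ] (punchIn w v) (punchIn w y) → InN[ G ─ w ] v y
  InN[]⇒InN[─] (inj₁ eq)  = inj₁ (punchIn-injective w _ _ eq)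
  InN[]⇒InN[─] (inj₂ v~y) = inj₂ v~y

  IsEDS⇒IsEDS-─ : ∀ {D} → w ∉ D → IsEDS G D → IsEDS (G ─ w) (removeAt D w)
  IsEDS⇒IsEDS-─ {D} w∉D eds v with u , (u∈D , u∈N) , unique ← eds (punchIn w v)
    with y , refl ← punchIn-surjective w {u} (λ { refl → w∉D u∈D }) =
    y , (punchIn∈p⇒∈removeAt w u∈D , InN[]⇒InN[─] u∈N) ,
    λ x x∈ x∈N → punchIn-injective w x y
      (unique _ (∈removeAt⇒punchIn∈p w x∈) (InN[─]⇒InN[] x∈N))

critical⇒¬HasEDS : ∀ {m} (G : Graph (suc m)) {u v} → Adj G u v →
                   IsVertexDomCritical G → ¬ HasEDS G
critical⇒¬HasEDS G u~v critical (D , eds) with w , w∉D ← IsEDS⇒∃∉ G eds u~v =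
  <-irrefl (∣removeAt∣≡∣p∣ w w∉D)
    (critical w _ _ (IsEDS⇒IsDomNumber G eds)
                    (IsEDS⇒IsDomNumber (G ─ w) (IsEDS⇒IsEDS-─ G w w∉D eds)))

proposition3p14 : (m : ℕ) (G : Graph (suc (suc m))) →
    Connected G → IsVertexDomCritical G →
    IsHypoEfficient G ⇔ (∀ v → HasEDS (G ─ v))
proposition3p14 m G connected critical with _◅_ 0~v _ ← connected zero (suc zero) =
  mk⇔ proj₂ (λ hasEDS-─ → critical⇒¬HasEDS G 0~v critical , hasEDS-─)
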